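{- For every positive integer $d$, $\pi(P_{d+1},d)\geq \frac{d!}{(d+1)^{d-1}}$, where $P_{d+1}$ is a perfect path in $Q_d$.
   Context: $Q_n$ is the $n$-dimensional hypercube graph: vertices are binary $n$-tuples, adjacent iff they differ in exactly one coordinate. A sub-$d$-cube of $Q_n$ is obtained by fixing $n-d$ coordinates and letting the other $d$ vary; there are $\binom{n}{d}2^{n-d}$ of them, each identified with $Q_d$ via its varying coordinates. A configuration in $Q_d$ is a subset of $V(Q_d)$. $K$ is an exact copy of $H$ if some automorphism of $Q_d$ maps $H$ onto $K$. For a configuration $H$ in $Q_d$ and $S\subseteq V(Q_n)$, let $g(H,d,n,S)$ be the fraction of sub-$d$-cubes $R$ of $Q_n$ for which $S\cap R$ is an exact copy of $H$, $\mathrm{ex}(H,d,n)=\max_{S\subseteq V(Q_n)} g(H,d,n,S)$ (nonincreasing in $n$), and $\pi(H,d)=\lim_{n\to\infty}\mathrm{ex}(H,d,n)$. A perfect path $P_{d+1}$ in $Q_d$ is the vertex set of a path in $Q_d$ with $d+1$ vertices whose endpoints are at Hamming distance $d$. -}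

module Defs where

open import Data.Nat using (ℕ; zero; suc; _+_)
open import Data.Bool using (Bool; true; false)
open import Data.Maybe using (Maybe; just; nothing)
open import Data.Vec using (Vec; []; _∷_; toList)
open import Data.List using (List; []; _∷_)
open import Data.Fin using (Fin; fromℕ; inject₁)
open import Data.Product using (Σ; ∃; _×_)
open import Function.Bundles using (_⇔_)
open import Function.Definitions using (Injective)
open import Relation.Binary.PropositionalEquality using (_≡_)

Vertex : ℕ → Set
Vertex n = Vec Bool n

hamming : ∀ {n} → Vertex n → Vertex n → ℕ
hamming [] [] = 0
hamming (true ∷ xs) (true ∷ ys) = hamming xs ys
hamming (false ∷ xs) (false ∷ ys) = hamming xs ys
hamming (true ∷ xs) (false ∷ ys) = suc (hamming xs ys)
hamming (false ∷ xs) (true ∷ ys) = suc (hamming xs ys)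

Adj : ∀ {n} → Vertex n → Vertex n → Set
Adj x y = hamming x y ≡ 1

Config : ℕ → Set₁
Config d = Vertex d → Set

record Automorphism (d : ℕ) : Set where
  field
    fun : Vertex d → Vertex d
    inv : Vertex d → Vertex d
    inv-fun : ∀ x → inv (fun x) ≡ x
    fun-inv : ∀ y → fun (inv y) ≡ y
    adj-pres : ∀ x y → Adj x y ⇔ Adj (fun x) (fun y)

ExactCopy : ∀ {d} → Config d → Config d → Set
ExactCopy {d} H K = Σ (Automorphism d) λ σ →
  ∀ x → H x ⇔ K (Automorphism.fun σ x)

-- Sub-d-cubes of Q_n: words over {0,1,*} (just false, just true, nothing)
-- with exactly d stars; the stars are the varying coordinates.
stars : ∀ {n} → Vec (Maybe Bool) n → ℕ
stars [] = 0
stars (just _ ∷ r) = stars r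
stars (nothing ∷ r) = suc (stars r)

IsSubcube : ∀ (d : ℕ) {n} → Vec (Maybe Bool) n → Set
IsSubcube d R = stars R ≡ d

-- The vertex of Q_n obtained by filling the stars of R, in increasing
-- coordinate order, with the given bits (identification of R with Q_d).
fill : ∀ {n} → Vec (Maybe Bool) n → List Bool → Vertex n
fill [] _ = []
fill (just b ∷ r) xs = b ∷ fill r xs
fill (nothing ∷ r) [] = false ∷ fill r []
fill (nothing ∷ r) (x ∷ xs) = x ∷ fill r xs

-- S ∩ R viewed as a configuration in Q_d.
restrict : ∀ {n d} → (Vertex n → Bool) → Vec (Maybe Bool) n → Config d
restrict S R x = S (fill R (toList x)) ≡ true

record IsPerfectPath (d : ℕ) (p : Fin (suc d) → Vertex d) : Set where
  field
    distinct : Injective _≡_ _≡_ p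
    steps : ∀ (i : Fin d) → Adj (p (inject₁ i)) (p (Fin.suc i))
    ends : hamming (p Fin.zero) (p (fromℕ d)) ≡ d

PathConfig : ∀ {d} → (Fin (suc d) → Vertex d) → Config d
PathConfig p x = ∃ λ i → p i ≡ x

-- Colour the n coordinates of Q_n with d + 1 colours and send a vertex to its colour-parity
-- vector in Q_(d+1).  Let S be the preimage of the antipodal cycle of length 2(d + 1) in
-- Q_(d+1), whose vertices are the vectors 1^a 0^(d+1-a) and their complements.  If the d free
-- coordinates of a sub-d-cube R receive distinct colours, missing the colour μ, then R is
-- mapped isomorphically onto the face y_μ = const of Q_(d+1), which the cycle meets in d + 1
-- consecutive vertices: a perfect path, whose coordinates are flipped in the cyclic order of
-- the colours after μ.  All perfect paths of Q_d are equivalent under signed permutations of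
-- the coordinates, so S ∩ R is an exact copy of P_(d+1).  For a random colouring, a fixed
-- sub-d-cube gets distinct colours with probability (d + 1)! / (d + 1)^d, so some colouring
-- does at least that well on the C(n, d) 2^(n-d) sub-cubes, which is the bound.

module Submission where

open import Defs
open import Data.Nat using (ℕ; _≤_; _*_; _^_; _∸_; suc; _!)
open import Data.Nat.Combinatorics using (_C_)
open import Data.Bool using (Bool)
open import Data.Maybe using (Maybe)
open import Data.Vec using (Vec)
open import Data.Fin using (Fin)
open import Data.List using (List; length)
open import Data.List.Relation.Unary.All using (All)
open import Data.List.Relation.Unary.Unique.Propositional using (Unique)
open import Data.Product using (Σ; _×_)

open import Data.Bool using (true; false; not; _∧_; _xor_; if_then_else_)
open import Data.Bool.Properties
  using (xor-assoc; xor-comm; xor-same; xor-identityʳ; xor-annihilates-not; ∧-zeroʳ; ∧-identityʳ)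
open import Data.Fin using (zero; suc; toℕ; inject₁; fromℕ; fromℕ<; lower₁; punchOut; _≟_)
import Data.Fin.Properties as Fin
open import Data.Fin.Properties
  using (any?; all?; ¬∀⟶∃¬; 0≢1+n; punchOut-injective; injective⇒≤; lower₁-injective; toℕ-lower₁;
         toℕ≤pred[n]; toℕ-fromℕ<; toℕ-inject₁; toℕ-injective)
open import Data.Fin.Induction using (<-weakInduction)
open import Data.Fin.Permutation
  using (Permutation′; permutation; _⟨$⟩ʳ_; _⟨$⟩ˡ_; inverseˡ; inverseʳ; _∘ₚ_) renaming (flip to _⁻¹)
open import Data.Fin.Subset using (Subset; inside; outside; ∣_∣; ∁)
import Data.Fin.Subset as Subset
open import Data.Fin.Subset.Properties using (∣∁p∣≡n∸∣p∣; ∣⊥∣≡0)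
import Data.List as List
open import Data.List.Membership.Propositional.Properties using (∈-map⁻; ∈-++⁻)
open import Data.List.Properties using (length-++; length-map)
open import Data.List.Relation.Binary.Disjoint.Propositional using (Disjoint)
import Data.List.Relation.Unary.All as All
import Data.List.Relation.Unary.All.Properties as AllP
import Data.List.Relation.Unary.AllPairs as AllPairs
import Data.List.Relation.Unary.Unique.Propositional.Properties as UP
open import Data.Maybe using (just; nothing)
import Data.Nat as ℕ
open import Data.Nat using (zero; pred; NonZero; _+_; _<_; _<ᵇ_; z≤n; s≤s)
open import Data.Nat.Combinatorics using (nCk+nC[k+1]≡[n+1]C[k+1])
open import Data.Nat.Properties
  using (+-*-semiring; suc-injective; 1+n≰n; n≮n; ≤-refl; ≤-reflexive; ≤-trans; ≤-<-trans; <⇒≤; <⇒≢;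
         <⇒≱; <⇒≯; ≤⇒≯; ≰⇒>; <-≤-connex; m≤n⇒m≤1+n; m≤m+n; m∸n+n≡m; m+[n∸m]≡n; +-suc; +-comm;
         +-assoc; +-identityʳ; +-mono-≤; +-monoʳ-≤; +-monoˡ-<; +-cancelʳ-<; +-cancelʳ-≤; +-cancelˡ-≡;
         +-cancelʳ-≡; *-assoc; *-comm; *-identityˡ; *-monoʳ-≤; *-monoˡ-≤; *-cancelˡ-≤; m*n≢0; m^n≢0;
         ^-distribˡ-+-*; module ≤-Reasoning)
open import Data.Nat.Tactic.RingSolver using (solve-∀)
open import Algebra.Properties.Semiring.Sum +-*-semiring
  using (sum-syntax; sum-cong-≗; sum-replicate-zero; ∑-permute; ∑-distrib-+; *-distribˡ-sum; *-distribʳ-sum)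
open import Data.Product using (∃; _,_; proj₁; proj₂)
open import Data.Sum using (inj₁; inj₂)
open import Data.Vec using ([]; _∷_; lookup; tabulate; updateAt; toList; _[_]≔_)
open import Data.Vec.Properties
  using (∷-injectiveˡ; ∷-injectiveʳ; lookup∘tabulate; tabulate∘lookup; tabulate-cong; lookup∘updateAt;
         lookup∘updateAt′; lookup∘update; lookup∘update′)
open import Function.Base using (_∘_)
open import Function.Bundles using (_⇔_; mk⇔; Equivalence)
open import Function.Construct.Composition using (_⇔-∘_)
open import Function.Definitions using (Injective)
open import Relation.Binary.PropositionalEquality
open import Relation.Nullary using (¬_; Dec; yes; no; does; contradiction)
open import Relation.Nullary.Decidable using (does-⇔; dec-true; dec-false)

xor-cancelʳ : ∀ x y → (x xor y) xor y ≡ x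
xor-cancelʳ x y = trans (xor-assoc x y y) (trans (cong (x xor_) (xor-same y)) (xor-identityʳ x))

xor-cancel-middle : ∀ x y z → (x xor y) xor (x xor z) ≡ y xor z
xor-cancel-middle false y z = refl
xor-cancel-middle true  y z = xor-annihilates-not y z

xor-cancel-both : ∀ x y z → (x xor z) xor (y xor z) ≡ x xor y
xor-cancel-both x y z = trans (cong₂ _xor_ (xor-comm x z) (xor-comm y z)) (xor-cancel-middle z x y)

xor-injectiveʳ : ∀ {x y} z → x xor z ≡ y xor z → x ≡ y
xor-injectiveʳ {x} {y} z e = trans (sym (xor-cancelʳ x z)) (trans (cong (_xor z) e) (xor-cancelʳ y z))

xor-exchange : ∀ x y z → x xor (y xor z) ≡ y xor (x xor z)
xor-exchange false y z = refl
xor-exchange true  false z = refl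
xor-exchange true  true  z = refl

<ᵇ-suc : ∀ m n → (m <ᵇ suc n) ≡ does (m ℕ.≟ n) xor (m <ᵇ n)
<ᵇ-suc zero    zero    = refl
<ᵇ-suc zero    (suc n) = refl
<ᵇ-suc (suc m) zero    = refl
<ᵇ-suc (suc m) (suc n) = <ᵇ-suc m n

lookup-extensional : ∀ {A : Set} {n} {x y : Vec A n} → (∀ i → lookup x i ≡ lookup y i) → x ≡ y
lookup-extensional {x = x} {y} x≗y =
  trans (sym (tabulate∘lookup x)) (trans (tabulate-cong x≗y) (tabulate∘lookup y))

flipAt : ∀ {n} → Fin n → Vertex n → Vertex n
flipAt i x = updateAt x i not

lookup-flipAt : ∀ {n} (i : Fin n) x j → lookup (flipAt i x) j ≡ does (i ≟ j) xor lookup x j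
lookup-flipAt i x j with i ≟ j
... | yes refl = lookup∘updateAt i x
... | no i≢j   = lookup∘updateAt′ j i (i≢j ∘ sym) x

hamming≡0⇒≡ : ∀ {n} (x y : Vertex n) → hamming x y ≡ 0 → x ≡ y
hamming≡0⇒≡ []           []           _ = refl
hamming≡0⇒≡ (true ∷ x)  (true ∷ y)  h = cong (true ∷_) (hamming≡0⇒≡ x y h)
hamming≡0⇒≡ (false ∷ x) (false ∷ y) h = cong (false ∷_) (hamming≡0⇒≡ x y h)

adj⇒flipAt : ∀ {n} (x y : Vertex n) → Adj x y → ∃ λ i → y ≡ flipAt i x
adj⇒flipAt []           []           ()
adj⇒flipAt (true ∷ x)  (true ∷ y)  h = let i , e = adj⇒flipAt x y h in suc i , cong (true ∷_) e
adj⇒flipAt (false ∷ x) (false ∷ y) h = let i , e = adj⇒flipAt x y h in suc i , cong (false ∷_) e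
adj⇒flipAt (true ∷ x)  (false ∷ y) h = zero , cong (false ∷_) (sym (hamming≡0⇒≡ x y (suc-injective h)))
adj⇒flipAt (false ∷ x) (true ∷ y)  h = zero , cong (true ∷_) (sym (hamming≡0⇒≡ x y (suc-injective h)))

hamming≤n : ∀ {n} (x y : Vertex n) → hamming x y ≤ n
hamming≤n []           []           = z≤n
hamming≤n (true ∷ x)  (true ∷ y)  = m≤n⇒m≤1+n (hamming≤n x y)
hamming≤n (false ∷ x) (false ∷ y) = m≤n⇒m≤1+n (hamming≤n x y)
hamming≤n (true ∷ x)  (false ∷ y) = s≤s (hamming≤n x y)
hamming≤n (false ∷ x) (true ∷ y)  = s≤s (hamming≤n x y)

hamming≡n⇒lookup≢ : ∀ {n} (x y : Vertex n) → hamming x y ≡ n → ∀ i → lookup x i ≢ lookup y i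
hamming≡n⇒lookup≢ (true ∷ x)  (true ∷ y)  h _ _ = 1+n≰n (subst (_≤ _) h (hamming≤n x y))
hamming≡n⇒lookup≢ (false ∷ x) (false ∷ y) h _ _ = 1+n≰n (subst (_≤ _) h (hamming≤n x y))
hamming≡n⇒lookup≢ (true ∷ x)  (false ∷ y) h zero    ()
hamming≡n⇒lookup≢ (false ∷ x) (true ∷ y)  h zero    ()
hamming≡n⇒lookup≢ (true ∷ x)  (false ∷ y) h (suc i) = hamming≡n⇒lookup≢ x y (suc-injective h) i
hamming≡n⇒lookup≢ (false ∷ x) (true ∷ y)  h (suc i) = hamming≡n⇒lookup≢ x y (suc-injective h) i

differ : Bool → Bool → ℕ
differ a b = if a xor b then 1 else 0

hamming≡∑differ : ∀ {n} (x y : Vertex n) → hamming x y ≡ ∑[ i < n ] differ (lookup x i) (lookup y i)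
hamming≡∑differ []           []           = refl
hamming≡∑differ (true ∷ x)  (true ∷ y)  = hamming≡∑differ x y
hamming≡∑differ (false ∷ x) (false ∷ y) = hamming≡∑differ x y
hamming≡∑differ (true ∷ x)  (false ∷ y) = cong suc (hamming≡∑differ x y)
hamming≡∑differ (false ∷ x) (true ∷ y)  = cong suc (hamming≡∑differ x y)

-- Automorphisms of the cube

signedPermute : ∀ {d} → Permutation′ d → Vertex d → Vertex d → Vertex d
signedPermute φ c x = tabulate λ l → lookup x (φ ⟨$⟩ʳ l) xor lookup c l

lookup-signedPermute : ∀ {d} (φ : Permutation′ d) c x l →
  lookup (signedPermute φ c x) l ≡ lookup x (φ ⟨$⟩ʳ l) xor lookup c l
lookup-signedPermute φ c x l = lookup∘tabulate _ l

signedPermute-isometry : ∀ {d} (φ : Permutation′ d) c x y →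
  hamming (signedPermute φ c x) (signedPermute φ c y) ≡ hamming x y
signedPermute-isometry {d} φ c x y = begin
  hamming (σ x) (σ y)
    ≡⟨ hamming≡∑differ (σ x) (σ y) ⟩
  ∑[ l < d ] differ (lookup (σ x) l) (lookup (σ y) l)
    ≡⟨ sum-cong-≗ (λ l → cong (if_then 1 else 0) (shift-cancels l)) ⟩
  ∑[ l < d ] differ (lookup x (φ ⟨$⟩ʳ l)) (lookup y (φ ⟨$⟩ʳ l))
    ≡⟨ ∑-permute (λ i → differ (lookup x i) (lookup y i)) φ ⟨
  ∑[ i < d ] differ (lookup x i) (lookup y i)
    ≡⟨ hamming≡∑differ x y ⟨
  hamming x y ∎
  where
  open ≡-Reasoning
  σ = signedPermute φ c
  shift-cancels : ∀ l → lookup (σ x) l xor lookup (σ y) l ≡ lookup x (φ ⟨$⟩ʳ l) xor lookup y (φ ⟨$⟩ʳ l)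
  shift-cancels l = begin
    lookup (σ x) l xor lookup (σ y) l
      ≡⟨ cong₂ _xor_ (lookup-signedPermute φ c x l) (lookup-signedPermute φ c y l) ⟩
    (lookup x (φ ⟨$⟩ʳ l) xor lookup c l) xor (lookup y (φ ⟨$⟩ʳ l) xor lookup c l)
      ≡⟨ cong₂ _xor_ (xor-comm _ (lookup c l)) (xor-comm _ (lookup c l)) ⟩
    (lookup c l xor lookup x (φ ⟨$⟩ʳ l)) xor (lookup c l xor lookup y (φ ⟨$⟩ʳ l))
      ≡⟨ xor-cancel-middle (lookup c l) _ _ ⟩
    lookup x (φ ⟨$⟩ʳ l) xor lookup y (φ ⟨$⟩ʳ l) ∎

isometry⇒automorphism : ∀ {d} (f g : Vertex d → Vertex d) →
  (∀ x → g (f x) ≡ x) → (∀ y → f (g y) ≡ y) → (∀ x y → hamming (f x) (f y) ≡ hamming x y) →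
  Automorphism d
isometry⇒automorphism f g g∘f f∘g isometry = record
  { fun = f ; inv = g ; inv-fun = g∘f ; fun-inv = f∘g
  ; adj-pres = λ x y → mk⇔ (trans (isometry x y)) (trans (sym (isometry x y))) }

signedPermutation : ∀ {d} → Permutation′ d → Vertex d → Automorphism d
signedPermutation {d} φ c = isometry⇒automorphism σ σ⁻¹ σ⁻¹∘σ σ∘σ⁻¹ (signedPermute-isometry φ c)
  where
  open ≡-Reasoning
  σ = signedPermute φ c
  σ⁻¹ : Vertex d → Vertex d
  σ⁻¹ y = tabulate λ i → lookup y (φ ⟨$⟩ˡ i) xor lookup c (φ ⟨$⟩ˡ i)
  σ⁻¹∘σ : ∀ x → σ⁻¹ (σ x) ≡ x
  σ⁻¹∘σ x = lookup-extensional λ i → begin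
    lookup (σ⁻¹ (σ x)) i                                  ≡⟨ lookup∘tabulate _ i ⟩
    lookup (σ x) (φ ⟨$⟩ˡ i) xor lookup c (φ ⟨$⟩ˡ i)      ≡⟨ cong (_xor _) (lookup-signedPermute φ c x _) ⟩
    (lookup x (φ ⟨$⟩ʳ (φ ⟨$⟩ˡ i)) xor lookup c (φ ⟨$⟩ˡ i)) xor lookup c (φ ⟨$⟩ˡ i)
                                                          ≡⟨ xor-cancelʳ _ _ ⟩
    lookup x (φ ⟨$⟩ʳ (φ ⟨$⟩ˡ i))                          ≡⟨ cong (lookup x) (inverseʳ φ) ⟩
    lookup x i                                            ∎
  σ∘σ⁻¹ : ∀ y → σ (σ⁻¹ y) ≡ y
  σ∘σ⁻¹ y = lookup-extensional λ l → begin
    lookup (σ (σ⁻¹ y)) l                        ≡⟨ lookup-signedPermute φ c (σ⁻¹ y) l ⟩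
    lookup (σ⁻¹ y) (φ ⟨$⟩ʳ l) xor lookup c l    ≡⟨ cong (_xor lookup c l) (lookup∘tabulate _ (φ ⟨$⟩ʳ l)) ⟩
    (lookup y (φ ⟨$⟩ˡ (φ ⟨$⟩ʳ l)) xor lookup c (φ ⟨$⟩ˡ (φ ⟨$⟩ʳ l))) xor lookup c l
                                                ≡⟨ cong (λ i → (lookup y i xor lookup c i) xor lookup c l) (inverseˡ φ) ⟩
    (lookup y l xor lookup c l) xor lookup c l  ≡⟨ xor-cancelʳ _ _ ⟩
    lookup y l                                  ∎

ExactCopy-cong : ∀ {d} {H H′ K K′ : Config d} → (∀ x → H x ⇔ H′ x) → (∀ x → K x ⇔ K′ x) →
  ExactCopy H′ K′ → ExactCopy H K
ExactCopy-cong H⇔H′ K⇔K′ (σ , H′⇔K′) = σ , λ x →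
  let open Equivalence in
  mk⇔ (from (K⇔K′ _) ∘ to (H′⇔K′ x) ∘ to (H⇔H′ x)) (from (H⇔H′ x) ∘ from (H′⇔K′ x) ∘ to (K⇔K′ _))

injective⇒surjective : ∀ {n} {f : Fin n → Fin n} → Injective _≡_ _≡_ f → ∀ i → ∃ λ l → f l ≡ i
injective⇒surjective {suc n} {f} f-inj i with any? (λ l → f l ≟ i)
... | yes hit = hit
... | no miss = contradiction (injective⇒≤ {f = f′} f′-inj) 1+n≰n
  where
  f′ : Fin (suc n) → Fin n
  f′ l = punchOut {i = i} λ i≡fl → miss (l , sym i≡fl)
  f′-inj : Injective _≡_ _≡_ f′
  f′-inj {l₁} {l₂} =
    f-inj ∘ punchOut-injective {i = i} (λ i≡fl → miss (l₁ , sym i≡fl)) (λ i≡fl → miss (l₂ , sym i≡fl))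

injective⇒permutation : ∀ {n} (f : Fin n → Fin n) → Injective _≡_ _≡_ f → Permutation′ n
injective⇒permutation f f-inj = permutation f (proj₁ ∘ surj) (proj₂ ∘ surj) (λ l → f-inj (proj₂ (surj (f l))))
  where surj = injective⇒surjective f-inj

surjective⇒injective : ∀ {n} {f : Fin n → Fin n} → (∀ i → ∃ λ l → f l ≡ i) → Injective _≡_ _≡_ f
surjective⇒injective {f = f} surj {l₁} {l₂} fl₁≡fl₂ = begin
  l₁                    ≡⟨ sym (inverseʳ π) ⟩
  g (π ⟨$⟩ˡ l₁)         ≡⟨ cong g (trans (sym (f∘π≗π⁻¹ l₁)) (trans fl₁≡fl₂ (f∘π≗π⁻¹ l₂))) ⟩
  g (π ⟨$⟩ˡ l₂)         ≡⟨ inverseʳ π ⟩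
  l₂                    ∎
  where
  open ≡-Reasoning
  g = proj₁ ∘ surj
  π = injective⇒permutation g λ {i} {j} gi≡gj → trans (sym (proj₂ (surj i))) (trans (cong f gi≡gj) (proj₂ (surj j)))
  f∘π≗π⁻¹ : ∀ l → f l ≡ π ⟨$⟩ˡ l
  f∘π≗π⁻¹ l = trans (cong f (sym (inverseʳ π))) (proj₂ (surj (π ⟨$⟩ˡ l)))

-- Perfect paths

-- The path from b that flips the coordinates in the order ρ⁻¹ 0, ρ⁻¹ 1, …
Staircase : ∀ {d} → Vertex d → Permutation′ d → Config d
Staircase {d} b ρ x = ∃ λ (k : Fin (suc d)) → ∀ i → lookup x i xor lookup b i ≡ (toℕ (ρ ⟨$⟩ʳ i) <ᵇ toℕ k)

staircase-exactCopy : ∀ {d} (b : Vertex d) ρ b′ ρ′ → ExactCopy (Staircase b ρ) (Staircase b′ ρ′)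
staircase-exactCopy {d} b ρ b′ ρ′ = signedPermutation φ c , λ x → mk⇔ (to x) (from x)
  where
  φ = ρ′ ∘ₚ ρ ⁻¹
  c = tabulate λ l → lookup b (φ ⟨$⟩ʳ l) xor lookup b′ l
  σ = signedPermute φ c
  offset-σ : ∀ x l → lookup (σ x) l xor lookup b′ l ≡ lookup x (φ ⟨$⟩ʳ l) xor lookup b (φ ⟨$⟩ʳ l)
  offset-σ x l = begin
    lookup (σ x) l xor lookup b′ l
      ≡⟨ cong (_xor lookup b′ l) (trans (lookup-signedPermute φ c x l)
           (cong (lookup x (φ ⟨$⟩ʳ l) xor_) (lookup∘tabulate (λ l → lookup b (φ ⟨$⟩ʳ l) xor lookup b′ l) l))) ⟩
    (lookup x (φ ⟨$⟩ʳ l) xor (lookup b (φ ⟨$⟩ʳ l) xor lookup b′ l)) xor lookup b′ l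
      ≡⟨ cong (_xor lookup b′ l) (sym (xor-assoc (lookup x (φ ⟨$⟩ʳ l)) _ _)) ⟩
    ((lookup x (φ ⟨$⟩ʳ l) xor lookup b (φ ⟨$⟩ʳ l)) xor lookup b′ l) xor lookup b′ l
      ≡⟨ xor-cancelʳ _ _ ⟩
    lookup x (φ ⟨$⟩ʳ l) xor lookup b (φ ⟨$⟩ʳ l) ∎
    where open ≡-Reasoning
  rank-φ : ∀ l → ρ ⟨$⟩ʳ (φ ⟨$⟩ʳ l) ≡ ρ′ ⟨$⟩ʳ l
  rank-φ l = inverseʳ ρ
  to : ∀ x → Staircase b ρ x → Staircase b′ ρ′ (σ x)
  to x (k , x-offset) = k , λ l →
    trans (offset-σ x l) (trans (x-offset _) (cong (λ j → toℕ j <ᵇ toℕ k) (rank-φ l)))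
  from : ∀ x → Staircase b′ ρ′ (σ x) → Staircase b ρ x
  from x (k , σx-offset) = k , λ i → let l = φ ⟨$⟩ˡ i ; i≡φl = sym (inverseʳ φ) in
    subst (λ j → lookup x j xor lookup b j ≡ (toℕ (ρ ⟨$⟩ʳ j) <ᵇ toℕ k)) (sym i≡φl)
      (trans (sym (offset-σ x l)) (trans (σx-offset l) (cong (λ j → toℕ j <ᵇ toℕ k) (sym (rank-φ l)))))

IsWalk : ∀ {m d} → (Fin (suc m) → Vertex d) → (Fin m → Fin d) → Set
IsWalk p t = ∀ l → p (suc l) ≡ flipAt (t l) (p (inject₁ l))

walk-unflipped : ∀ {m d} {p : Fin (suc m) → Vertex d} {t} → IsWalk p t →
  ∀ i → (∀ l → t l ≢ i) → ∀ k → lookup (p k) i ≡ lookup (p zero) i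
walk-unflipped {p = p} {t} walk i unflipped = <-weakInduction (λ k → lookup (p k) i ≡ lookup (p zero) i) refl step
  where
  step : ∀ l → lookup (p (inject₁ l)) i ≡ lookup (p zero) i → lookup (p (suc l)) i ≡ lookup (p zero) i
  step l ih = begin
    lookup (p (suc l)) i                                 ≡⟨ cong (λ v → lookup v i) (walk l) ⟩
    lookup (flipAt (t l) (p (inject₁ l))) i              ≡⟨ lookup-flipAt (t l) (p (inject₁ l)) i ⟩
    does (t l ≟ i) xor lookup (p (inject₁ l)) i          ≡⟨ cong (_xor _) (dec-false (t l ≟ i) (unflipped l)) ⟩
    lookup (p (inject₁ l)) i                             ≡⟨ ih ⟩
    lookup (p zero) i                                    ∎
    where open ≡-Reasoning

walk-staircase : ∀ {d} {p : Fin (suc d) → Vertex d} (π : Permutation′ d) → IsWalk p (π ⟨$⟩ʳ_) →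
  ∀ x → (∃ λ k → p k ≡ x) ⇔ Staircase (p zero) (π ⁻¹) x
walk-staircase {d} {p} π walk x = mk⇔ (λ { (k , refl) → k , offset k }) λ (k , x-offset) →
  k , lookup-extensional λ i → trans (sym (xor-cancelʳ _ (lookup (p zero) i)))
        (trans (cong (_xor _) (trans (offset k i) (sym (x-offset i)))) (xor-cancelʳ _ _))
  where
  open ≡-Reasoning
  Offset : Fin (suc d) → Set
  Offset k = ∀ i → lookup (p k) i xor lookup (p zero) i ≡ (toℕ (π ⟨$⟩ˡ i) <ᵇ toℕ k)
  flips-at-rank : ∀ l i → does (π ⟨$⟩ʳ l ≟ i) ≡ does (toℕ (π ⟨$⟩ˡ i) ℕ.≟ toℕ l)
  flips-at-rank l i = does-⇔
    (mk⇔ (λ { refl → cong toℕ (inverseˡ π) }) λ e → trans (cong (π ⟨$⟩ʳ_) (sym (toℕ-injective e))) (inverseʳ π))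
    (π ⟨$⟩ʳ l ≟ i) (toℕ (π ⟨$⟩ˡ i) ℕ.≟ toℕ l)
  step : ∀ l → Offset (inject₁ l) → Offset (suc l)
  step l ih i = begin
    lookup (p (suc l)) i xor lookup (p zero) i
      ≡⟨ cong (λ v → lookup v i xor _) (walk l) ⟩
    lookup (flipAt (π ⟨$⟩ʳ l) (p (inject₁ l))) i xor lookup (p zero) i
      ≡⟨ cong (_xor _) (lookup-flipAt (π ⟨$⟩ʳ l) (p (inject₁ l)) i) ⟩
    (does (π ⟨$⟩ʳ l ≟ i) xor lookup (p (inject₁ l)) i) xor lookup (p zero) i
      ≡⟨ xor-assoc (does (π ⟨$⟩ʳ l ≟ i)) _ _ ⟩
    does (π ⟨$⟩ʳ l ≟ i) xor (lookup (p (inject₁ l)) i xor lookup (p zero) i)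
      ≡⟨ cong₂ _xor_ (flips-at-rank l i) (trans (ih i) (cong (toℕ (π ⟨$⟩ˡ i) <ᵇ_) (toℕ-inject₁ l))) ⟩
    does (toℕ (π ⟨$⟩ˡ i) ℕ.≟ toℕ l) xor (toℕ (π ⟨$⟩ˡ i) <ᵇ toℕ l)
      ≡⟨ sym (<ᵇ-suc (toℕ (π ⟨$⟩ˡ i)) (toℕ l)) ⟩
    (toℕ (π ⟨$⟩ˡ i) <ᵇ suc (toℕ l)) ∎
  offset : ∀ k → Offset k
  offset = <-weakInduction Offset (λ i → xor-same (lookup (p zero) i)) step

module _ {d} {p : Fin (suc d) → Vertex d} (perfect : IsPerfectPath d p) where
  open IsPerfectPath perfect

  stepCoordinate : Fin d → Fin d
  stepCoordinate l = proj₁ (adj⇒flipAt (p (inject₁ l)) (p (suc l)) (steps l))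

  perfectPath-walk : IsWalk p stepCoordinate
  perfectPath-walk l = proj₂ (adj⇒flipAt (p (inject₁ l)) (p (suc l)) (steps l))

  -- The last vertex is antipodal to the first, so no coordinate is left unflipped.
  stepCoordinate-surjective : ∀ i → ∃ λ l → stepCoordinate l ≡ i
  stepCoordinate-surjective i with any? (λ l → stepCoordinate l ≟ i)
  ... | yes flipped = flipped
  ... | no unflipped = contradiction
    (sym (walk-unflipped {p = p} perfectPath-walk i (λ l e → unflipped (l , e)) (fromℕ d)))
    (hamming≡n⇒lookup≢ (p zero) (p (fromℕ d)) ends i)

  perfectPath-staircase : ∃ λ ρ → ∀ x → PathConfig p x ⇔ Staircase (p zero) ρ x
  perfectPath-staircase = π ⁻¹ , walk-staircase π perfectPath-walk
    where π = injective⇒permutation stepCoordinate (surjective⇒injective stepCoordinate-surjective)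

-- The antipodal cycle in the cube of colours

<ᵇ-true : ∀ {m n} → m < n → (m <ᵇ n) ≡ true
<ᵇ-true {m} {n} = dec-true (m ℕ.<? n)

<ᵇ-false : ∀ {m n} → ¬ m < n → (m <ᵇ n) ≡ false
<ᵇ-false {m} {n} = dec-false (m ℕ.<? n)

<ᵇ-translate : ∀ {m n m′ n′} k → m + k ≡ m′ → n + k ≡ n′ → (m <ᵇ n) ≡ (m′ <ᵇ n′)
<ᵇ-translate {m} {n} k refl refl = does-⇔ (mk⇔ (+-monoˡ-< k) (+-cancelʳ-< k m n)) (m ℕ.<? n) (m + k ℕ.<? n + k)

module _ (d μ : ℕ) where
  open ≡-Reasoning

  -- The position of the colour j in the cyclic order μ + 1, …, d, 0, …, μ.
  rotate : ℕ → ℕ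
  rotate j with μ ℕ.<? j
  ... | yes _ = j ∸ suc μ
  ... | no  _ = d + j ∸ μ

  rotate-> : ∀ {j} → μ < j → rotate j + suc μ ≡ j
  rotate-> {j} μ<j with μ ℕ.<? j
  ... | yes _   = m∸n+n≡m μ<j
  ... | no μ≮j = contradiction μ<j μ≮j

  rotate-≤ : ∀ {j} → μ ≤ d → j ≤ μ → rotate j + μ ≡ d + j
  rotate-≤ {j} μ≤d j≤μ with μ ℕ.<? j
  ... | yes μ<j = contradiction j≤μ (<⇒≱ μ<j)
  ... | no  _   = m∸n+n≡m (≤-trans μ≤d (m≤m+n d j))

  rotate≤d : ∀ {j} → μ ≤ d → j ≤ d → rotate j ≤ d
  rotate≤d {j} μ≤d j≤d with <-≤-connex μ j
  ... | inj₁ μ<j = ≤-trans (m≤m+n (rotate j) (suc μ)) (≤-trans (≤-reflexive (rotate-> μ<j)) j≤d)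
  ... | inj₂ j≤μ = +-cancelʳ-≤ μ (rotate j) d (≤-trans (≤-reflexive (rotate-≤ μ≤d j≤μ))
                     (+-monoʳ-≤ d j≤μ))

  rotate-across : ∀ {j a} → μ < j → j ≤ d → a ≤ μ → μ ≤ d → rotate j < rotate a
  rotate-across {j} {a} μ<j j≤d a≤μ μ≤d = +-cancelʳ-≤ μ (suc (rotate j)) (rotate a)
    (≤-trans (≤-reflexive (trans (sym (+-suc (rotate j) μ)) (rotate-> μ<j)))
    (≤-trans j≤d (≤-trans (m≤m+n d a) (≤-reflexive (sym (rotate-≤ μ≤d a≤μ))))))

  -- Rotation reverses a comparison exactly when the two colours lie on different sides of μ.
  rotate-<ᵇ : ∀ {j a} → μ ≤ d → j ≤ d → a ≤ d →
    ((j <ᵇ a) xor (μ <ᵇ a)) xor (μ <ᵇ j) ≡ (rotate j <ᵇ rotate a)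
  rotate-<ᵇ {j} {a} μ≤d j≤d a≤d with <-≤-connex μ j | <-≤-connex μ a
  ... | inj₁ μ<j | inj₁ μ<a = begin
    ((j <ᵇ a) xor (μ <ᵇ a)) xor (μ <ᵇ j)
      ≡⟨ cong₂ (λ u v → ((j <ᵇ a) xor u) xor v) (<ᵇ-true μ<a) (<ᵇ-true μ<j) ⟩
    ((j <ᵇ a) xor true) xor true          ≡⟨ xor-cancelʳ (j <ᵇ a) true ⟩
    (j <ᵇ a)                              ≡⟨ <ᵇ-translate (suc μ) (rotate-> μ<j) (rotate-> μ<a) ⟨
    (rotate j <ᵇ rotate a)                ∎
  ... | inj₂ j≤μ | inj₂ a≤μ = begin
    ((j <ᵇ a) xor (μ <ᵇ a)) xor (μ <ᵇ j)
      ≡⟨ cong₂ (λ u v → ((j <ᵇ a) xor u) xor v) (<ᵇ-false (≤⇒≯ a≤μ)) (<ᵇ-false (≤⇒≯ j≤μ)) ⟩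
    ((j <ᵇ a) xor false) xor false        ≡⟨ xor-cancelʳ (j <ᵇ a) false ⟩
    (j <ᵇ a)                              ≡⟨ <ᵇ-translate {j} {a} d refl refl ⟩
    (j + d <ᵇ a + d)                      ≡⟨ <ᵇ-translate μ (trans (rotate-≤ μ≤d j≤μ) (+-comm d j))
                                                             (trans (rotate-≤ μ≤d a≤μ) (+-comm d a)) ⟨
    (rotate j <ᵇ rotate a)                ∎
  ... | inj₁ μ<j | inj₂ a≤μ = begin
    ((j <ᵇ a) xor (μ <ᵇ a)) xor (μ <ᵇ j)
      ≡⟨ cong₂ (λ u v → (u xor v) xor (μ <ᵇ j)) (<ᵇ-false (<⇒≯ (≤-<-trans a≤μ μ<j))) (<ᵇ-false (≤⇒≯ a≤μ)) ⟩
    (μ <ᵇ j)                              ≡⟨ <ᵇ-true μ<j ⟩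
    true                                  ≡⟨ <ᵇ-true (rotate-across μ<j j≤d a≤μ μ≤d) ⟨
    (rotate j <ᵇ rotate a)                ∎
  ... | inj₂ j≤μ | inj₁ μ<a = begin
    ((j <ᵇ a) xor (μ <ᵇ a)) xor (μ <ᵇ j)
      ≡⟨ cong₂ (λ u v → (u xor v) xor (μ <ᵇ j)) (<ᵇ-true (≤-<-trans j≤μ μ<a)) (<ᵇ-true μ<a) ⟩
    (μ <ᵇ j)                              ≡⟨ <ᵇ-false (≤⇒≯ j≤μ) ⟩
    false                                 ≡⟨ <ᵇ-false (<⇒≯ (rotate-across μ<a a≤d j≤μ μ≤d)) ⟨
    (rotate j <ᵇ rotate a)                ∎

  rotate-injective : ∀ {j a} → μ ≤ d → j ≤ d → a ≤ d → rotate j ≡ rotate a → j ≡ a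
  rotate-injective {j} {a} μ≤d j≤d a≤d e with <-≤-connex μ j | <-≤-connex μ a
  ... | inj₁ μ<j | inj₁ μ<a = trans (sym (rotate-> μ<j)) (trans (cong (_+ suc μ) e) (rotate-> μ<a))
  ... | inj₂ j≤μ | inj₂ a≤μ =
    +-cancelˡ-≡ d j a (trans (sym (rotate-≤ μ≤d j≤μ)) (trans (cong (_+ μ) e) (rotate-≤ μ≤d a≤μ)))
  ... | inj₁ μ<j | inj₂ a≤μ = contradiction e (<⇒≢ (rotate-across μ<j j≤d a≤μ μ≤d))
  ... | inj₂ j≤μ | inj₁ μ<a = contradiction (sym e) (<⇒≢ (rotate-across μ<a a≤d j≤μ μ≤d))

  rotate-self : μ ≤ d → rotate μ ≡ d
  rotate-self μ≤d = +-cancelʳ-≡ μ (rotate μ) d (rotate-≤ μ≤d ≤-refl)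

module Rotation {d} (μ : Fin (suc d)) where

  rot : Fin (suc d) → Fin (suc d)
  rot j = fromℕ< (s≤s (rotate≤d d (toℕ μ) (toℕ≤pred[n] μ) (toℕ≤pred[n] j)))

  toℕ-rot : ∀ j → toℕ (rot j) ≡ rotate d (toℕ μ) (toℕ j)
  toℕ-rot j = toℕ-fromℕ< _

  rot-injective : Injective _≡_ _≡_ rot
  rot-injective {j} {a} e = toℕ-injective (rotate-injective d (toℕ μ) (toℕ≤pred[n] μ) (toℕ≤pred[n] j) (toℕ≤pred[n] a)
    (trans (sym (toℕ-rot j)) (trans (cong toℕ e) (toℕ-rot a))))

  rotation : Permutation′ (suc d)
  rotation = injective⇒permutation rot rot-injective

  toℕ-rot-self : toℕ (rot μ) ≡ d
  toℕ-rot-self = trans (toℕ-rot μ) (rotate-self d (toℕ μ) (toℕ≤pred[n] μ))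

  rot-<ᵇ : ∀ j a →
    ((toℕ j <ᵇ toℕ a) xor (toℕ μ <ᵇ toℕ a)) xor (toℕ μ <ᵇ toℕ j) ≡ (toℕ (rot j) <ᵇ toℕ (rot a))
  rot-<ᵇ j a = trans (rotate-<ᵇ d (toℕ μ) (toℕ≤pred[n] μ) (toℕ≤pred[n] j) (toℕ≤pred[n] a))
                     (sym (cong₂ _<ᵇ_ (toℕ-rot j) (toℕ-rot a)))

-- The vectors 1^a 0^(d+1-a) and their complements, which form an isometric cycle in Q_(d+1)
-- (a ≤ d suffices: 1^(d+1) is the complement of 0^(d+1)).
Threshold : ∀ {d} → (Fin (suc d) → Bool) → Set
Threshold {d} y = ∃ λ (a : Fin (suc d)) → ∃ λ b → ∀ j → y j xor b ≡ (toℕ j <ᵇ toℕ a)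

∃-Bool? : ∀ {P : Bool → Set} → (∀ b → Dec (P b)) → Dec (∃ P)
∃-Bool? P? with P? false | P? true
... | yes p | _     = yes (false , p)
... | no _  | yes p = yes (true , p)
... | no ¬p | no ¬q = no λ { (false , p) → ¬p p ; (true , q) → ¬q q }

threshold? : ∀ {d} (y : Fin (suc d) → Bool) → Dec (Threshold y)
threshold? y = any? λ a → ∃-Bool? λ b → all? λ j → y j xor b Data.Bool.≟ (toℕ j <ᵇ toℕ a)

-- On the face through y the cycle is a staircase, read in the rotated order of the colours.
threshold-face : ∀ {d} (μ : Fin (suc d)) (y : Fin (suc d) → Bool) → let open Rotation μ in
  Threshold y ⇔ ∃ λ k → ∀ j → (y j xor y μ) xor (toℕ μ <ᵇ toℕ j) ≡ (toℕ (rot j) <ᵇ toℕ k)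
threshold-face μ y = mk⇔ to from
  where
  open Rotation μ
  open ≡-Reasoning
  to : Threshold y → ∃ λ k → ∀ j → (y j xor y μ) xor (toℕ μ <ᵇ toℕ j) ≡ (toℕ (rot j) <ᵇ toℕ k)
  to (a , b , y-offset) = rot a , λ j → begin
    (y j xor y μ) xor (toℕ μ <ᵇ toℕ j)                       ≡⟨ cong (_xor _) (xor-cancel-both (y j) (y μ) b) ⟨
    ((y j xor b) xor (y μ xor b)) xor (toℕ μ <ᵇ toℕ j)       ≡⟨ cong₂ (λ u v → (u xor v) xor _) (y-offset j) (y-offset μ) ⟩
    ((toℕ j <ᵇ toℕ a) xor (toℕ μ <ᵇ toℕ a)) xor (toℕ μ <ᵇ toℕ j) ≡⟨ rot-<ᵇ j a ⟩
    (toℕ (rot j) <ᵇ toℕ (rot a))                             ∎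
  from : (∃ λ k → ∀ j → (y j xor y μ) xor (toℕ μ <ᵇ toℕ j) ≡ (toℕ (rot j) <ᵇ toℕ k)) → Threshold y
  from (k , y-face) = a , y μ xor A , λ j → begin
    y j xor (y μ xor A)              ≡⟨ xor-assoc (y j) (y μ) A ⟨
    (y j xor y μ) xor A              ≡⟨ cong (_xor A) (face-offset j) ⟩
    ((toℕ j <ᵇ toℕ a) xor A) xor A   ≡⟨ xor-cancelʳ _ A ⟩
    (toℕ j <ᵇ toℕ a)                 ∎
    where
    a = rotation ⟨$⟩ˡ k
    A = toℕ μ <ᵇ toℕ a
    face-offset : ∀ j → y j xor y μ ≡ (toℕ j <ᵇ toℕ a) xor A
    face-offset j = xor-injectiveʳ (toℕ μ <ᵇ toℕ j) (begin
      (y j xor y μ) xor (toℕ μ <ᵇ toℕ j)             ≡⟨ y-face j ⟩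
      (toℕ (rot j) <ᵇ toℕ k)                         ≡⟨ cong (λ k → toℕ (rot j) <ᵇ toℕ k) (inverseʳ rotation) ⟨
      (toℕ (rot j) <ᵇ toℕ (rot a))                   ≡⟨ rot-<ᵇ j a ⟨
      ((toℕ j <ᵇ toℕ a) xor A) xor (toℕ μ <ᵇ toℕ j)  ∎)

-- Colourings

colourParity : ∀ {m n} → Vec (Fin m) n → Vertex n → Fin m → Bool
colourParity []       []      j = false
colourParity (c ∷ cs) (b ∷ v) j = (b ∧ does (c ≟ j)) xor colourParity cs v j

colourSet : ∀ {d n} → Vec (Fin (suc d)) n → Vertex n → Bool
colourSet c v = does (threshold? (colourParity c v))

starColours : ∀ {m n} → Vec (Fin m) n → (R : Vec (Maybe Bool) n) → Vec (Fin m) (stars R)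
starColours []       []            = []
starColours (c ∷ cs) (just _ ∷ R)  = starColours cs R
starColours (c ∷ cs) (nothing ∷ R) = c ∷ starColours cs R

colourParity-fill : ∀ {m n} (c : Vec (Fin m) n) R (x : Vec Bool (stars R)) j →
  colourParity c (fill R (toList x)) j ≡ colourParity c (fill R List.[]) j xor colourParity (starColours c R) x j
colourParity-fill []       []            []      j = refl
colourParity-fill (c ∷ cs) (just b ∷ R)  x       j =
  trans (cong ((b ∧ does (c ≟ j)) xor_) (colourParity-fill cs R x j)) (sym (xor-assoc (b ∧ does (c ≟ j)) _ _))
colourParity-fill (c ∷ cs) (nothing ∷ R) (b ∷ x) j =
  trans (cong ((b ∧ does (c ≟ j)) xor_) (colourParity-fill cs R x j))
        (xor-exchange (b ∧ does (c ≟ j)) (colourParity cs (fill R List.[]) j) _)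

colourParity-absent : ∀ {m k} (κ : Vec (Fin m) k) x j → (∀ l → lookup κ l ≢ j) → colourParity κ x j ≡ false
colourParity-absent []       []      j _      = refl
colourParity-absent (c ∷ κ) (b ∷ x) j absent = cong₂ _xor_
  (trans (cong (b ∧_) (dec-false (c ≟ j) (absent zero))) (∧-zeroʳ b))
  (colourParity-absent κ x j (absent ∘ suc))

colourParity-present : ∀ {m k} (κ : Vec (Fin m) k) x → Injective _≡_ _≡_ (lookup κ) →
  ∀ l → colourParity κ x (lookup κ l) ≡ lookup x l
colourParity-present (c ∷ κ) (b ∷ x) κ-inj zero = trans (cong₂ _xor_
  (trans (cong (b ∧_) (dec-true (c ≟ c) refl)) (∧-identityʳ b))
  (colourParity-absent κ x c λ l e → 0≢1+n (κ-inj (sym e)))) (xor-identityʳ b)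
colourParity-present (c ∷ κ) (b ∷ x) κ-inj (suc l) = cong₂ _xor_
  (trans (cong (b ∧_) (dec-false (c ≟ lookup κ l) λ e → 0≢1+n (κ-inj e))) (∧-zeroʳ b))
  (colourParity-present κ x (Fin.suc-injective ∘ κ-inj) l)

<⇒∃-missed : ∀ {m n} (f : Fin m → Fin n) → m < n → ∃ λ j → ∀ l → f l ≢ j
<⇒∃-missed {m} {n} f m<n =
  let j , unhit = ¬∀⟶∃¬ n (λ j → ∃ λ l → f l ≡ j) (λ j → any? λ l → f l ≟ j) not-surjective
  in j , λ l e → unhit (l , e)
  where
  not-surjective : ¬ (∀ j → ∃ λ l → f l ≡ j)
  not-surjective surj = <⇒≱ m<n (injective⇒≤ {f = proj₁ ∘ surj}
    λ {i} {j} e → trans (sym (proj₂ (surj i))) (trans (cong f e) (proj₂ (surj j))))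

does≡true⇔ : ∀ {A : Set} (a? : Dec A) → does a? ≡ true ⇔ A
does≡true⇔ (yes a) = mk⇔ (λ _ → a) (λ _ → refl)
does≡true⇔ (no ¬a) = mk⇔ (λ ()) (λ a → contradiction a ¬a)

module _ {n} (R : Vec (Maybe Bool) n) (c : Vec (Fin (suc (stars R))) n)
         (κ-inj : Injective _≡_ _≡_ (lookup (starColours c R)))
         (μ : Fin (suc (stars R))) (μ-missed : ∀ l → lookup (starColours c R) l ≢ μ) where
  private
    d = stars R
    κ = lookup (starColours c R)
    O = colourParity c (fill R List.[])
    y : Vertex d → Fin (suc d) → Bool
    y x = colourParity c (fill R (toList x))
  open Rotation μ

  private
    rot≢d : ∀ {j} → j ≢ μ → d ≢ toℕ (rot j)
    rot≢d j≢μ e = j≢μ (rot-injective (toℕ-injective (trans (sym e) (sym toℕ-rot-self))))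

    position : Fin d → Fin d
    position l = lower₁ (rot (κ l)) (rot≢d (μ-missed l))

    π : Permutation′ d
    π = injective⇒permutation position (κ-inj ∘ rot-injective ∘ lower₁-injective)

    covered : ∀ {j} → j ≢ μ → ∃ λ l → κ l ≡ j
    covered {j} j≢μ = π ⟨$⟩ˡ q , rot-injective (lower₁-injective (inverseʳ π))
      where q = lower₁ (rot j) (rot≢d j≢μ)

    base-bit : Fin d → Bool
    base-bit l = (O (κ l) xor O μ) xor (toℕ μ <ᵇ toℕ (κ l))

    base : Vertex d
    base = tabulate base-bit

    y-κ : ∀ x l → y x (κ l) ≡ O (κ l) xor lookup x l
    y-κ x l = trans (colourParity-fill c R x (κ l)) (cong (O (κ l) xor_) (colourParity-present (starColours c R) x κ-inj l))

    y-μ : ∀ x → y x μ ≡ O μ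
    y-μ x = trans (colourParity-fill c R x μ)
      (trans (cong (O μ xor_) (colourParity-absent (starColours c R) x μ μ-missed)) (xor-identityʳ _))

    offset-κ : ∀ x l → (y x (κ l) xor y x μ) xor (toℕ μ <ᵇ toℕ (κ l)) ≡ lookup x l xor lookup base l
    offset-κ x l = begin
      (y x (κ l) xor y x μ) xor M               ≡⟨ cong₂ (λ u v → (u xor v) xor M) (y-κ x l) (y-μ x) ⟩
      ((O (κ l) xor lookup x l) xor O μ) xor M  ≡⟨ cong (λ u → (u xor O μ) xor M) (xor-comm (O (κ l)) (lookup x l)) ⟩
      ((lookup x l xor O (κ l)) xor O μ) xor M  ≡⟨ cong (_xor M) (xor-assoc (lookup x l) (O (κ l)) (O μ)) ⟩
      (lookup x l xor (O (κ l) xor O μ)) xor M  ≡⟨ xor-assoc (lookup x l) (O (κ l) xor O μ) M ⟩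
      lookup x l xor ((O (κ l) xor O μ) xor M)  ≡⟨ cong (lookup x l xor_) (lookup∘tabulate (base-bit) l) ⟨
      lookup x l xor lookup base l              ∎
      where
      open ≡-Reasoning
      M = toℕ μ <ᵇ toℕ (κ l)

    rank : ∀ {k : Fin (suc d)} l → (toℕ (rot (κ l)) <ᵇ toℕ k) ≡ (toℕ (π ⟨$⟩ʳ l) <ᵇ toℕ k)
    rank {k} l = cong (_<ᵇ toℕ k) (sym (toℕ-lower₁ _ (rot≢d (μ-missed l))))

    face-offset : ∀ x k → (∀ l → lookup x l xor lookup base l ≡ (toℕ (π ⟨$⟩ʳ l) <ᵇ toℕ k)) →
      ∀ j → (y x j xor y x μ) xor (toℕ μ <ᵇ toℕ j) ≡ (toℕ (rot j) <ᵇ toℕ k)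
    face-offset x k stair j with j ≟ μ
    ... | yes refl = begin
      (y x μ xor y x μ) xor (toℕ μ <ᵇ toℕ μ)  ≡⟨ cong₂ _xor_ (xor-same (y x μ)) (<ᵇ-false (n≮n (toℕ μ))) ⟩
      false                                   ≡⟨ <ᵇ-false (≤⇒≯ (toℕ≤pred[n] k)) ⟨
      (d <ᵇ toℕ k)                            ≡⟨ cong (_<ᵇ toℕ k) toℕ-rot-self ⟨
      (toℕ (rot μ) <ᵇ toℕ k)                  ∎
      where open ≡-Reasoning
    ... | no j≢μ = subst (λ j → (y x j xor y x μ) xor (toℕ μ <ᵇ toℕ j) ≡ (toℕ (rot j) <ᵇ toℕ k)) κl≡j
                     (trans (offset-κ x l) (trans (stair l) (sym (rank {k} l))))
      where
      l = proj₁ (covered j≢μ)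
      κl≡j = proj₂ (covered j≢μ)

    face⇔staircase : ∀ x → (∃ λ k → ∀ j → (y x j xor y x μ) xor (toℕ μ <ᵇ toℕ j) ≡ (toℕ (rot j) <ᵇ toℕ k)) ⇔
      Staircase base π x
    face⇔staircase x = mk⇔ (λ (k , face) → k , λ l → trans (sym (offset-κ x l)) (trans (face (κ l)) (rank {k} l)))
                           (λ (k , stair) → k , face-offset x k stair)

  restrict-staircase′ : ∃ λ b → ∃ λ π → ∀ x → restrict (colourSet c) R x ⇔ Staircase b π x
  restrict-staircase′ = base , π , λ x →
    face⇔staircase x ⇔-∘ (threshold-face μ (y x) ⇔-∘ does≡true⇔ (threshold? (y x)))

restrict-staircase : ∀ {n} (R : Vec (Maybe Bool) n) (c : Vec (Fin (suc (stars R))) n) →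
  Injective _≡_ _≡_ (lookup (starColours c R)) →
  ∃ λ b → ∃ λ π → ∀ x → restrict (colourSet c) R x ⇔ Staircase b π x
restrict-staircase R c κ-inj with <⇒∃-missed (lookup (starColours c R)) ≤-refl
... | μ , μ-missed = restrict-staircase′ R c κ-inj μ μ-missed

-- Counting

-- A is the set of colours already used by stars (inside = used).
goodSubcubes : ∀ {m n} → Vec (Fin m) n → ℕ → Subset m → List (Vec (Maybe Bool) n)
starredSubcubes : ∀ {m n} → Fin m → Vec (Fin m) n → ℕ → Subset m → List (Vec (Maybe Bool) n)

goodSubcubes []       zero    A = List.[ [] ]
goodSubcubes []       (suc k) A = List.[]
goodSubcubes (c ∷ cs) k       A = List.map (just false ∷_) (goodSubcubes cs k A)
                             List.++ List.map (just true ∷_) (goodSubcubes cs k A)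
                             List.++ List.map (nothing ∷_) (starredSubcubes c cs k A)

starredSubcubes c cs zero    A = List.[]
starredSubcubes c cs (suc k) A = if lookup A c then List.[] else goodSubcubes cs k (A [ c ]≔ inside)

≔inside-outside : ∀ {m} (A : Subset m) c j → lookup (A [ c ]≔ inside) j ≡ outside → j ≢ c × lookup A j ≡ outside
≔inside-outside A c j j-free with j ≟ c
... | yes refl = contradiction (trans (sym (lookup∘update j A inside)) j-free) λ ()
... | no j≢c  = j≢c , trans (sym (lookup∘update′ j≢c A inside)) j-free

lookup-∷-injective : ∀ {m k} {c : Fin m} {κ : Vec (Fin m) k} → (∀ l → lookup κ l ≢ c) →
  Injective _≡_ _≡_ (lookup κ) → Injective _≡_ _≡_ (lookup (c ∷ κ))
lookup-∷-injective fresh κ-inj {zero}  {zero}   _ = refl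
lookup-∷-injective fresh κ-inj {zero}  {suc l}  e = contradiction (sym e) (fresh l)
lookup-∷-injective fresh κ-inj {suc l} {zero}   e = contradiction e (fresh l)
lookup-∷-injective fresh κ-inj {suc l} {suc l′} e = cong suc (κ-inj e)

IsGoodSubcube : ∀ {m n} → Vec (Fin m) n → ℕ → Subset m → Vec (Maybe Bool) n → Set
IsGoodSubcube c k A R = stars R ≡ k × (∀ l → lookup A (lookup (starColours c R) l) ≡ outside)
                                    × Injective _≡_ _≡_ (lookup (starColours c R))

goodSubcubes-good : ∀ {m n} (c : Vec (Fin m) n) k A → All (IsGoodSubcube c k A) (goodSubcubes c k A)
goodSubcubes-good []       zero    A = (refl , (λ ()) , λ {}) All.∷ All.[]
goodSubcubes-good []       (suc k) A = All.[]
goodSubcubes-good (c ∷ cs) k       A = AllP.++⁺ (AllP.map⁺ (goodSubcubes-good cs k A))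
  (AllP.++⁺ (AllP.map⁺ (goodSubcubes-good cs k A)) (AllP.map⁺ (starred k)))
  where
  starred : ∀ k → All (IsGoodSubcube (c ∷ cs) k A ∘ (nothing ∷_)) (starredSubcubes c cs k A)
  starred zero = All.[]
  starred (suc k) with lookup A c in c-free
  ... | inside  = All.[]
  ... | outside = All.map extend (goodSubcubes-good cs k (A [ c ]≔ inside))
    where
    extend : ∀ {R} → IsGoodSubcube cs k (A [ c ]≔ inside) R → IsGoodSubcube (c ∷ cs) (suc k) A (nothing ∷ R)
    extend (stars≡k , free , κ-inj) = cong suc stars≡k , free′ , lookup-∷-injective (proj₁ ∘ fresh∧free) κ-inj
      where
      fresh∧free = λ l → ≔inside-outside A c _ (free l)
      free′ : ∀ l → lookup A (lookup (c ∷ _) l) ≡ outside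
      free′ zero    = c-free
      free′ (suc l) = proj₂ (fresh∧free l)

map-∷-disjoint : ∀ {A : Set} {n} {a b : A} → a ≢ b → (xs ys : List (Vec A n)) →
  Disjoint (List.map (a ∷_) xs) (List.map (b ∷_) ys)
map-∷-disjoint {a = a} {b} a≢b xs ys (v∈a , v∈b) with ∈-map⁻ (a ∷_) v∈a | ∈-map⁻ (b ∷_) v∈b
... | _ , _ , refl | _ , _ , e = a≢b (∷-injectiveˡ e)

map-∷-unique : ∀ {A : Set} {n} {a : A} {xs : List (Vec A n)} → Unique xs → Unique (List.map (a ∷_) xs)
map-∷-unique = UP.map⁺ ∷-injectiveʳ

disjoint-++ʳ : ∀ {A : Set} {xs ys zs : List A} → Disjoint xs ys → Disjoint xs zs → Disjoint xs (ys List.++ zs)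
disjoint-++ʳ {ys = ys} xs#ys xs#zs (v∈xs , v∈ys++zs) with ∈-++⁻ ys v∈ys++zs
... | inj₁ v∈ys = xs#ys (v∈xs , v∈ys)
... | inj₂ v∈zs = xs#zs (v∈xs , v∈zs)

goodSubcubes-unique : ∀ {m n} (c : Vec (Fin m) n) k A → Unique (goodSubcubes c k A)
goodSubcubes-unique []       zero    A = All.[] AllPairs.∷ AllPairs.[]
goodSubcubes-unique []       (suc k) A = AllPairs.[]
goodSubcubes-unique (c ∷ cs) k       A =
  UP.++⁺ (map-∷-unique fixed) (UP.++⁺ (map-∷-unique fixed) (map-∷-unique (starred k)) (map-∷-disjoint (λ ()) L S))
         (disjoint-++ʳ (map-∷-disjoint (λ ()) L L) (map-∷-disjoint (λ ()) L S))
  where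
  fixed = goodSubcubes-unique cs k A
  L = goodSubcubes cs k A
  S = starredSubcubes c cs k A
  starred : ∀ k → Unique (starredSubcubes c cs k A)
  starred zero = AllPairs.[]
  starred (suc k) with lookup A c
  ... | inside  = AllPairs.[]
  ... | outside = goodSubcubes-unique cs k (A [ c ]≔ inside)

∑-zero : ∀ m → ∑[ j < m ] 0 ≡ 0
∑-zero m = sum-replicate-zero m

∑-const : ∀ m x → ∑[ j < m ] x ≡ m * x
∑-const zero    x = refl
∑-const (suc m) x = cong (x +_) (∑-const m x)

∑-free : ∀ {m} (A : Subset m) → ∑[ j < m ] (if lookup A j then 0 else 1) ≡ ∣ ∁ A ∣
∑-free []             = refl
∑-free (inside  ∷ A) = ∑-free A
∑-free (outside ∷ A) = cong suc (∑-free A)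

∣∁∣-≔inside : ∀ {m} (A : Subset m) c → lookup A c ≡ outside → ∣ ∁ A ∣ ≡ suc ∣ ∁ (A [ c ]≔ inside) ∣
∣∁∣-≔inside (outside ∷ A) zero    _      = refl
∣∁∣-≔inside (inside  ∷ A) (suc c) c-free = ∣∁∣-≔inside A c c-free
∣∁∣-≔inside (outside ∷ A) (suc c) c-free = cong suc (∣∁∣-≔inside A c c-free)

∑-mono-≤ : ∀ {m} {f g : Fin m → ℕ} → (∀ i → f i ≤ g i) → ∑[ i < m ] f i ≤ ∑[ i < m ] g i
∑-mono-≤ {zero}  _   = z≤n
∑-mono-≤ {suc m} f≤g = +-mono-≤ (f≤g zero) (∑-mono-≤ (f≤g ∘ suc))

∑-argmax : ∀ m (g : Fin (suc m) → ℕ) → ∃ λ j → ∑[ i < suc m ] g i ≤ suc m * g j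
∑-argmax zero    g = zero , ≤-reflexive (cong (g zero +_) refl)
∑-argmax (suc m) g with ∑-argmax m (g ∘ suc)
... | j , ∑≤ with g zero ℕ.≤? g (suc j)
... | yes g₀≤gⱼ = suc j , +-mono-≤ g₀≤gⱼ ∑≤
... | no  g₀≰gⱼ = zero , +-monoʳ-≤ (g zero) (≤-trans ∑≤ (*-monoʳ-≤ (suc m) (<⇒≤ (≰⇒> g₀≰gⱼ))))

∑Vec : ∀ m n → (Vec (Fin m) n → ℕ) → ℕ
∑Vec m zero    f = f []
∑Vec m (suc n) f = ∑[ j < m ] ∑Vec m n (λ cs → f (j ∷ cs))

∑Vec-cong : ∀ m n {f g : Vec (Fin m) n → ℕ} → (∀ c → f c ≡ g c) → ∑Vec m n f ≡ ∑Vec m n g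
∑Vec-cong m zero    f≗g = f≗g []
∑Vec-cong m (suc n) f≗g = sum-cong-≗ λ j → ∑Vec-cong m n (f≗g ∘ (j ∷_))

∑Vec-zero : ∀ m n → ∑Vec m n (λ _ → 0) ≡ 0
∑Vec-zero m zero    = refl
∑Vec-zero m (suc n) = trans (sum-cong-≗ {m} {λ _ → ∑Vec m n (λ _ → 0)} (λ _ → ∑Vec-zero m n)) (∑-zero m)

∑Vec-distrib-+ : ∀ m n (f g : Vec (Fin m) n → ℕ) → ∑Vec m n (λ c → f c + g c) ≡ ∑Vec m n f + ∑Vec m n g
∑Vec-distrib-+ m zero    f g = refl
∑Vec-distrib-+ m (suc n) f g =
  trans (sum-cong-≗ λ j → ∑Vec-distrib-+ m n (f ∘ (j ∷_)) (g ∘ (j ∷_)))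
        (∑-distrib-+ (λ j → ∑Vec m n (f ∘ (j ∷_))) (λ j → ∑Vec m n (g ∘ (j ∷_))))

∑Vec-*ˡ : ∀ m n a (f : Vec (Fin m) n → ℕ) → ∑Vec m n (λ c → a * f c) ≡ a * ∑Vec m n f
∑Vec-*ˡ m zero    a f = refl
∑Vec-*ˡ m (suc n) a f =
  trans (sum-cong-≗ λ j → ∑Vec-*ˡ m n a (f ∘ (j ∷_))) (sym (*-distribˡ-sum a λ j → ∑Vec m n (f ∘ (j ∷_))))

∑Vec-average : ∀ m n (f : Vec (Fin (suc m)) n → ℕ) → ∃ λ c → ∑Vec (suc m) n f ≤ suc m ^ n * f c
∑Vec-average m zero    f = [] , ≤-reflexive (sym (+-identityʳ (f [])))
∑Vec-average m (suc n) f = j ∷ best j , (begin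
  ∑[ i < suc m ] ∑Vec (suc m) n (f ∘ (i ∷_))   ≤⟨ ∑-mono-≤ (λ i → proj₂ (∑Vec-average m n (f ∘ (i ∷_)))) ⟩
  ∑[ i < suc m ] (suc m ^ n * g i)             ≡⟨ *-distribˡ-sum (suc m ^ n) g ⟨
  suc m ^ n * (∑[ i < suc m ] g i)             ≤⟨ *-monoʳ-≤ (suc m ^ n) (proj₂ (∑-argmax m g)) ⟩
  suc m ^ n * (suc m * g j)                    ≡⟨ *-assoc (suc m ^ n) (suc m) (g j) ⟨
  suc m ^ n * suc m * g j                      ≡⟨ cong (_* g j) (*-comm (suc m ^ n) (suc m)) ⟩
  suc m * suc m ^ n * g j                      ∎)
  where
  open ≤-Reasoning
  best : Fin (suc m) → Vec (Fin (suc m)) n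
  best i = proj₁ (∑Vec-average m n (f ∘ (i ∷_)))
  g : Fin (suc m) → ℕ
  g i = f (i ∷ best i)
  j = proj₁ (∑-argmax m g)

goodCount : ℕ → ℕ → ℕ → ℕ → ℕ
starredCount : ℕ → ℕ → ℕ → ℕ → ℕ

goodCount m zero    zero    f = 1
goodCount m zero    (suc k) f = 0
goodCount m (suc n) k       f = 2 * m * goodCount m n k f + starredCount m n k f

starredCount m n zero    f = 0
starredCount m n (suc k) f = f * goodCount m n k (pred f)

length-goodSubcubes : ∀ {m n} c (cs : Vec (Fin m) n) k A →
  length (goodSubcubes (c ∷ cs) k A) ≡ 2 * length (goodSubcubes cs k A) + length (starredSubcubes c cs k A)
length-goodSubcubes c cs k A = begin
  length (List.map (just false ∷_) L List.++ List.map (just true ∷_) L List.++ List.map (nothing ∷_) S)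
    ≡⟨ length-++ (List.map (just false ∷_) L) ⟩
  length (List.map (just false ∷_) L) + length (List.map (just true ∷_) L List.++ List.map (nothing ∷_) S)
    ≡⟨ cong (length (List.map (just false ∷_) L) +_) (length-++ (List.map (just true ∷_) L)) ⟩
  length (List.map (just false ∷_) L) + (length (List.map (just true ∷_) L) + length (List.map (nothing ∷_) S))
    ≡⟨ cong₂ (λ u v → u + (v + length (List.map (nothing ∷_) S))) (length-map _ L) (length-map _ L) ⟩
  length L + (length L + length (List.map (nothing ∷_) S))
    ≡⟨ cong (λ u → length L + (length L + u)) (length-map _ S) ⟩
  length L + (length L + length S)
    ≡⟨ +-assoc (length L) (length L) (length S) ⟨
  length L + length L + length S
    ≡⟨ cong (λ a → length L + a + length S) (+-identityʳ (length L)) ⟨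
  2 * length L + length S ∎
  where
  open ≡-Reasoning
  L = goodSubcubes cs k A
  S = starredSubcubes c cs k A

∑Vec-goodSubcubes : ∀ m n k (A : Subset m) → ∑Vec m n (λ c → length (goodSubcubes c k A)) ≡ goodCount m n k ∣ ∁ A ∣
∑Vec-starredSubcubes : ∀ m n k (A : Subset m) →
  ∑[ j < m ] ∑Vec m n (λ cs → length (starredSubcubes j cs k A)) ≡ starredCount m n k ∣ ∁ A ∣

∑Vec-goodSubcubes m zero    zero    A = refl
∑Vec-goodSubcubes m zero    (suc k) A = refl
∑Vec-goodSubcubes m (suc n) k       A = begin
  ∑[ j < m ] ∑Vec m n (λ cs → length (goodSubcubes (j ∷ cs) k A))
    ≡⟨ sum-cong-≗ (λ j → ∑Vec-cong m n (λ cs → length-goodSubcubes j cs k A)) ⟩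
  ∑[ j < m ] ∑Vec m n (λ cs → 2 * length (goodSubcubes cs k A) + length (starredSubcubes j cs k A))
    ≡⟨ sum-cong-≗ (λ j → trans (∑Vec-distrib-+ m n (λ cs → 2 * length (goodSubcubes cs k A)) (S j))
                               (cong (_+ ∑Vec m n (S j)) (trans (∑Vec-*ˡ m n 2 (λ cs → length (goodSubcubes cs k A)))
                                                                  (cong (2 *_) (∑Vec-goodSubcubes m n k A))))) ⟩
  ∑[ j < m ] (2 * G + ∑Vec m n (S j))
    ≡⟨ ∑-distrib-+ (λ _ → 2 * G) (λ j → ∑Vec m n (S j)) ⟩
  ∑[ j < m ] (2 * G) + ∑[ j < m ] ∑Vec m n (λ cs → length (starredSubcubes j cs k A))
    ≡⟨ cong₂ _+_ (∑-const m (2 * G)) (∑Vec-starredSubcubes m n k A) ⟩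
  m * (2 * G) + starredCount m n k ∣ ∁ A ∣
    ≡⟨ cong (_+ starredCount m n k ∣ ∁ A ∣) (trans (sym (*-assoc m 2 G)) (cong (_* G) (*-comm m 2))) ⟩
  2 * m * G + starredCount m n k ∣ ∁ A ∣ ∎
  where
  open ≡-Reasoning
  G = goodCount m n k ∣ ∁ A ∣
  S : Fin m → Vec (Fin m) n → ℕ
  S j cs = length (starredSubcubes j cs k A)

∑Vec-starredSubcubes m n zero    A = trans (sum-cong-≗ {m} {λ _ → ∑Vec m n (λ _ → 0)} (λ _ → ∑Vec-zero m n)) (∑-zero m)
∑Vec-starredSubcubes m n (suc k) A = begin
  ∑[ j < m ] ∑Vec m n (λ cs → length (starredSubcubes j cs (suc k) A))
    ≡⟨ sum-cong-≗ per-colour ⟩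
  ∑[ j < m ] ((if lookup A j then 0 else 1) * G)
    ≡⟨ *-distribʳ-sum G (λ j → if lookup A j then 0 else 1) ⟨
  (∑[ j < m ] (if lookup A j then 0 else 1)) * G
    ≡⟨ cong (_* G) (∑-free A) ⟩
  ∣ ∁ A ∣ * G ∎
  where
  open ≡-Reasoning
  G = goodCount m n k (pred ∣ ∁ A ∣)
  per-colour : ∀ j → ∑Vec m n (λ cs → length (starredSubcubes j cs (suc k) A)) ≡ (if lookup A j then 0 else 1) * G
  per-colour j with lookup A j in j-free
  ... | inside  = ∑Vec-zero m n
  ... | outside = trans (∑Vec-goodSubcubes m n k (A [ j ]≔ inside))
                        (trans (cong (goodCount m n k ∘ pred) (sym (∣∁∣-≔inside A j j-free))) (sym (*-identityˡ G)))

fallingFactorial : ℕ → ℕ → ℕ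
fallingFactorial f zero    = 1
fallingFactorial f (suc k) = f * fallingFactorial (pred f) k

fallingFactorial-suc : ∀ n → fallingFactorial (suc n) n ≡ suc n !
fallingFactorial-suc zero    = refl
fallingFactorial-suc (suc n) = cong (suc (suc n) *_) (fallingFactorial-suc n)

goodCount-closed : ∀ m n k f →
  goodCount m n k f * (2 ^ k * m ^ k) ≡ (n C k) * fallingFactorial f k * (2 ^ n * m ^ n)
goodCount-closed m zero    zero    f = refl
goodCount-closed m zero    (suc k) f = refl
goodCount-closed m (suc n) zero    f = begin
  (2 * m * G + 0) * 1         ≡⟨ lhs m G ⟩
  2 * m * (G * 1)             ≡⟨ cong (2 * m *_) (goodCount-closed m n zero f) ⟩
  2 * m * (1 * 1 * (T * M))   ≡⟨ rhs m T M ⟩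
  1 * 1 * (2 * T * (m * M))   ∎
  where
  open ≡-Reasoning
  G = goodCount m n zero f
  T = 2 ^ n
  M = m ^ n
  lhs : ∀ m G → (2 * m * G + 0) * 1 ≡ 2 * m * (G * 1)
  lhs = solve-∀
  rhs : ∀ m T M → 2 * m * (1 * 1 * (T * M)) ≡ 1 * 1 * (2 * T * (m * M))
  rhs = solve-∀
goodCount-closed m (suc n) (suc k) f = begin
  (2 * m * G₁ + f * G₀) * (2 * Tₖ * (m * Mₖ))
    ≡⟨ lhs m f G₁ G₀ Tₖ Mₖ ⟩
  2 * m * (G₁ * (2 * Tₖ * (m * Mₖ))) + 2 * m * f * (G₀ * (Tₖ * Mₖ))
    ≡⟨ cong₂ (λ u v → 2 * m * u + 2 * m * f * v) (goodCount-closed m n (suc k) f) (goodCount-closed m n k (pred f)) ⟩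
  2 * m * ((n C suc k) * (f * F) * (T * M)) + 2 * m * f * ((n C k) * F * (T * M))
    ≡⟨ rhs m f (n C k) (n C suc k) F T M ⟩
  ((n C k) + (n C suc k)) * (f * F) * (2 * T * (m * M))
    ≡⟨ cong (λ c → c * (f * F) * (2 * T * (m * M))) (nCk+nC[k+1]≡[n+1]C[k+1] n k) ⟩
  (suc n C suc k) * (f * F) * (2 * T * (m * M)) ∎
  where
  open ≡-Reasoning
  G₁ = goodCount m n (suc k) f
  G₀ = goodCount m n k (pred f)
  Tₖ = 2 ^ k
  Mₖ = m ^ k
  T = 2 ^ n
  M = m ^ n
  F = fallingFactorial (pred f) k
  lhs : ∀ m f G₁ G₀ Tₖ Mₖ → (2 * m * G₁ + f * G₀) * (2 * Tₖ * (m * Mₖ)) ≡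
                            2 * m * (G₁ * (2 * Tₖ * (m * Mₖ))) + 2 * m * f * (G₀ * (Tₖ * Mₖ))
  lhs = solve-∀
  rhs : ∀ m f Cₖ Cₖ₊₁ F T M → 2 * m * (Cₖ₊₁ * (f * F) * (T * M)) + 2 * m * f * (Cₖ * F * (T * M)) ≡
                              (Cₖ + Cₖ₊₁) * (f * F) * (2 * T * (m * M))
  rhs = solve-∀

module _ (d′ : ℕ) where
  private
    d m : ℕ
    d = suc d′
    m = suc d

  averaging-bound : ∀ n L → d ≤ n → goodCount m n d m ≤ m ^ n * L → d ! * ((n C d) * 2 ^ (n ∸ d)) ≤ L * m ^ d′
  averaging-bound n L d≤n G≤ = *-cancelˡ-≤ K {{K≢0}} (begin
    K * (D * (B * 2 ^ r))                        ≡⟨ lhs Tᵈ Mᵈ Mʳ m D B (2 ^ r) ⟩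
    B * (m * D) * (Tᵈ * 2 ^ r * (Mᵈ * Mʳ))
      ≡⟨ cong₂ (λ u v → B * (m * D) * (u * v)) (^-distribˡ-+-* 2 d r) (^-distribˡ-+-* m d r) ⟨
    B * (m * D) * (2 ^ (d + r) * m ^ (d + r))    ≡⟨ cong (λ k → B * (m * D) * (2 ^ k * m ^ k)) n≡d+r ⟨
    B * (m * D) * (2 ^ n * m ^ n)                ≡⟨ cong (λ x → B * x * (2 ^ n * m ^ n)) (fallingFactorial-suc d) ⟨
    B * fallingFactorial m d * (2 ^ n * m ^ n)   ≡⟨ goodCount-closed m n d m ⟨
    goodCount m n d m * (Tᵈ * Mᵈ)                ≤⟨ *-monoˡ-≤ (Tᵈ * Mᵈ) G≤ ⟩
    m ^ n * L * (Tᵈ * Mᵈ)                        ≡⟨ cong (λ k → m ^ k * L * (Tᵈ * Mᵈ)) n≡d+r ⟩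
    m ^ (d + r) * L * (Tᵈ * Mᵈ)                  ≡⟨ cong (λ x → x * L * (Tᵈ * Mᵈ)) (^-distribˡ-+-* m d r) ⟩
    Mᵈ * Mʳ * L * (Tᵈ * (m * m ^ d′))            ≡⟨ rhs Tᵈ Mᵈ Mʳ m L (m ^ d′) ⟩
    K * (L * m ^ d′)                             ∎)
    where
    open ≤-Reasoning
    r = n ∸ d
    n≡d+r = sym (m+[n∸m]≡n d≤n)
    B = n C d
    D = d !
    Tᵈ = 2 ^ d
    Mᵈ = m ^ d
    Mʳ = m ^ r
    K = Tᵈ * Mᵈ * Mʳ * m
    lhs : ∀ Tᵈ Mᵈ Mʳ m D B Tʳ → Tᵈ * Mᵈ * Mʳ * m * (D * (B * Tʳ)) ≡ B * (m * D) * (Tᵈ * Tʳ * (Mᵈ * Mʳ))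
    lhs = solve-∀
    rhs : ∀ Tᵈ Mᵈ Mʳ m L M′ → Mᵈ * Mʳ * L * (Tᵈ * (m * M′)) ≡ Tᵈ * Mᵈ * Mʳ * m * (L * M′)
    rhs = solve-∀
    K≢0 : NonZero K
    K≢0 = m*n≢0 (Tᵈ * Mᵈ * Mʳ) m
      {{m*n≢0 (Tᵈ * Mᵈ) Mʳ {{m*n≢0 Tᵈ Mᵈ {{m^n≢0 2 d}} {{m^n≢0 m d}}}} {{m^n≢0 m r}}}}

goodSubcube-exactCopy : ∀ {d n} (c : Vec (Fin (suc d)) n) R → stars R ≡ d →
  Injective _≡_ _≡_ (lookup (starColours c R)) →
  ∀ {p} → IsPerfectPath d p → ExactCopy (PathConfig p) (restrict (colourSet c) R)
goodSubcube-exactCopy c R refl κ-inj {p} perfect =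
  let b , π , restrict⇔staircase = restrict-staircase R c κ-inj
      ρ , path⇔staircase = perfectPath-staircase perfect
  in ExactCopy-cong path⇔staircase restrict⇔staircase (staircase-exactCopy (p zero) ρ b π)

∣∁⊥∣≡n : ∀ n → ∣ ∁ (Subset.⊥ {n}) ∣ ≡ n
∣∁⊥∣≡n n = trans (∣∁p∣≡n∸∣p∣ (Subset.⊥ {n})) (cong (n ∸_) (∣⊥∣≡0 n))

proposition6 : ∀ (d : ℕ) → 1 ≤ d →
    (p : Fin (suc d) → Vertex d) → IsPerfectPath d p →
    ∀ (n : ℕ) → d ≤ n →
    Σ (Vertex n → Bool) λ S →
    Σ (List (Vec (Maybe Bool) n)) λ L →
      Unique L ×
      All (λ R → IsSubcube d R × ExactCopy (PathConfig p) (restrict S R)) L ×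
      (d !) * ((n C d) * 2 ^ (n ∸ d)) ≤ length L * (suc d) ^ (d ∸ 1)
proposition6 d@(suc d′) _ p perfect n d≤n =
  colourSet c , goodSubcubes c d Subset.⊥ ,
  goodSubcubes-unique c d Subset.⊥ ,
  All.map (λ {R} (stars≡d , _ , κ-inj) → stars≡d , goodSubcube-exactCopy c R stars≡d κ-inj perfect)
          (goodSubcubes-good c d Subset.⊥) ,
  averaging-bound d′ n L d≤n average≤
  where
  best = ∑Vec-average d n (λ c → length (goodSubcubes c d Subset.⊥))
  c = proj₁ best
  L = length (goodSubcubes c d Subset.⊥)
  average≤ : goodCount (suc d) n d (suc d) ≤ suc d ^ n * L
  average≤ = subst (_≤ suc d ^ n * L)
    (trans (∑Vec-goodSubcubes (suc d) n d Subset.⊥) (cong (goodCount (suc d) n d) (∣∁⊥∣≡n (suc d)))) (proj₂ best)
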